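{- For integers $n\geq 1$ and $0\leq k\leq n-1$, the number $op_{n,\geq k}$ of ordered preference sets of length $n$ with at least $k$ flaws equals $\binom{2n-1}{n-1-k}$.
   Context: Parking model: $n$ parking spaces numbered $1,\dots,n$ from left to right; a preference set of length $n$ is a sequence $(a_1,\dots,a_n)$ with $a_i\in[n]$. Cars $1,\dots,n$ arrive in order; car $i$ goes to space $a_i$, and if it is occupied, moves to the first unoccupied space to the right; if there is none, the car cannot park. The number of flaws of a preference set is the number of cars that cannot park. A preference set is ordered if $a_1\leq a_2\leq\cdots\leq a_n$. -}

module Defs where

open import Data.Nat using (ℕ; zero; suc; _≤_; _≤?_)
open import Data.Bool using (Bool; true; false; if_then_else_)
open import Data.Fin using (Fin; toℕ)
open import Data.Vec using (Vec; []; _∷_; lookup; replicate; updateAt)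
open import Data.List using (List; []; _∷_; _++_; map; concatMap; filter; length)
open import Data.Fin using () renaming (zero to fzero; suc to fsuc)
open import Data.Maybe using (Maybe; just; nothing)
open import Data.Product using (_×_; _,_)
open import Relation.Nullary.Decidable using (Dec; yes; no; _×-dec_)

-- A preference set of length n: cars 1..n, each preferring a space in [n]
-- (spaces 1..n are represented by Fin n, i.e. 0..n-1, order preserved).
PrefSet : ℕ → Set
PrefSet n = Vec (Fin n) n

-- Occupancy of the n spaces: true = occupied.
Occ : ℕ → Set
Occ n = Vec Bool n

firstFreeFrom : ∀ {n} → Occ n → ℕ → Maybe (Fin n)
firstFreeFrom [] p = nothing
firstFreeFrom (b ∷ bs) zero with b
... | false = just fzero
... | true  = Data.Maybe.map fsuc (firstFreeFrom bs zero)
firstFreeFrom (b ∷ bs) (suc p) = Data.Maybe.map fsuc (firstFreeFrom bs p)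

parkFlaws : ∀ {n m} → Occ n → Vec (Fin n) m → ℕ
parkFlaws occ [] = 0
parkFlaws occ (a ∷ as) with firstFreeFrom occ (toℕ a)
... | just s  = parkFlaws (updateAt occ s (λ _ → true)) as
... | nothing = suc (parkFlaws occ as)

flaws : ∀ {n} → PrefSet n → ℕ
flaws {n} a = parkFlaws (replicate n false) a

data Ordered {n : ℕ} : ∀ {m} → Vec (Fin n) m → Set where
  ord-[] : Ordered []
  ord-[x] : ∀ x → Ordered (x ∷ [])
  ord-∷ : ∀ {m} x y (ys : Vec (Fin n) m) →
          toℕ x ≤ toℕ y → Ordered (y ∷ ys) → Ordered (x ∷ y ∷ ys)

ordered? : ∀ {n m} (v : Vec (Fin n) m) → Dec (Ordered v)
ordered? [] = yes ord-[]
ordered? (x ∷ []) = yes (ord-[x] x)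
ordered? (x ∷ y ∷ ys) with toℕ x ≤? toℕ y | ordered? (y ∷ ys)
... | yes p | yes q = yes (ord-∷ x y ys p q)
... | no ¬p | _ = no λ { (ord-∷ _ _ _ p _) → ¬p p }
... | yes _ | no ¬q = no λ { (ord-∷ _ _ _ _ q) → ¬q q }

allFins : (n : ℕ) → List (Fin n)
allFins zero = []
allFins (suc n) = fzero ∷ map fsuc (allFins n)

allVecs : (n m : ℕ) → List (Vec (Fin n) m)
allVecs n zero = [] ∷ []
allVecs n (suc m) = concatMap (λ x → map (x ∷_) (allVecs n m)) (allFins n)

op≥ : (n k : ℕ) → ℕ
op≥ n k = length (filter (λ a → ordered? a ×-dec (k ≤? flaws a)) (allVecs n n))

-- For a nondecreasing preference set x₁ ≤ ⋯ ≤ xₙ (spaces 0, …, n − 1) the occupied spaces a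
-- car can run into always form one block growing to the right, so car i parks at
-- max(xᵢ, previous spot + 1) and the number of flaws is R − n (truncated at 0), where
-- R = maxᵢ (xᵢ + n − i + 1). Counting the nondecreasing sequences of length m over d values
-- from lo on with R ≥ c by whether the first entry is lo gives Pascal's recurrence, whence the
-- count C(m + d − 1, m + (c − lo − m)) for c = 0 or c ≥ lo + d. With m = d = n, lo = 0 and
-- c = n + k this is C(2n − 1, n + k) = C(2n − 1, n − 1 − k).
module Submission where

open import Defs
open import Data.Bool using (Bool; true; false; T; T?; if_then_else_; _∧_)
open import Data.Bool.Properties using (T-∧; ∧-assoc)
open import Data.Fin as Fin using (Fin; toℕ; fromℕ<) renaming (zero to fzero; suc to fsuc)
open import Data.Fin.Properties using (toℕ<n; toℕ-fromℕ<; toℕ-injective)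
open import Data.List using (List; []; _∷_; _++_; map; concat; concatMap; filter; length)
open import Data.List.Properties using (map-∘; map-cong)
open import Data.Maybe using (just; nothing)
import Data.Maybe as Maybe
open import Data.Nat using (ℕ; zero; suc; _≤_; _<_; _+_; _*_; _∸_; _⊔_; z≤n; s≤s; _≤ᵇ_; _<?_; _≤?_)
open import Data.Nat.Combinatorics using (_C_; k>n⇒nCk≡0; nCk+nC[k+1]≡[n+1]C[k+1]; nCk≡nC[n∸k])
open import Data.Nat.ListAction using (sum)
open import Data.Nat.Properties
open import Data.Product using (_×_; _,_)
open import Data.Sum using (_⊎_; inj₁; inj₂)
open import Data.Vec using (Vec; []; _∷_; lookup; replicate; updateAt)
open import Data.Vec.Properties using (lookup∘updateAt; lookup∘updateAt′; lookup-replicate)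
open import Function using (_∘_; _⇔_; mk⇔; Equivalence)
open import Level using (Level)
open import Relation.Binary.PropositionalEquality
open import Relation.Nullary using (¬_; Dec; yes; no; does; contradiction)
open import Relation.Nullary.Decidable using (does-⇔; dec-true; _×-dec_)
open import Relation.Unary using (Pred; Decidable)

private
  variable
    ℓ ℓ′ : Level
    A B : Set ℓ

≤ᵇ-suc : ∀ m n → (suc m ≤ᵇ suc n) ≡ (m ≤ᵇ n)
≤ᵇ-suc zero    n = refl
≤ᵇ-suc (suc m) n = refl

∸-sucʳ : ∀ {x c} → x < c → c ∸ x ≡ suc (c ∸ suc x)
∸-sucʳ {zero}  {suc c} _         = refl
∸-sucʳ {suc x} {suc c} (s≤s x<c) = ∸-sucʳ x<c

<-⊔-cancelˡ : ∀ {a t j} → j < a ⊔ t → a ≤ j → j < t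
<-⊔-cancelˡ j<a⊔t a≤j = ≰⇒> (λ t≤j → <⇒≱ j<a⊔t (⊔-lub a≤j t≤j))

⊔-blocked : ∀ {a t n} → a < n → t ≤ n → ¬ (a ⊔ t < n) → t ≡ n
⊔-blocked a<n t≤n a⊔t≮n = ≤-antisym t≤n (≮⇒≥ (λ t<n → a⊔t≮n (⊔-lub a<n t<n)))

count : (A → Bool) → List A → ℕ
count p []       = 0
count p (x ∷ xs) = if p x then suc (count p xs) else count p xs

count-++ : ∀ (p : A → Bool) xs ys → count p (xs ++ ys) ≡ count p xs + count p ys
count-++ p []       ys = refl
count-++ p (x ∷ xs) ys with p x
... | true  = cong suc (count-++ p xs ys)
... | false = count-++ p xs ys

count-cong : ∀ {p q : A → Bool} → (∀ x → p x ≡ q x) → ∀ xs → count p xs ≡ count q xs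
count-cong p≗q []       = refl
count-cong {q = q} p≗q (x ∷ xs) rewrite p≗q x with q x
... | true  = cong suc (count-cong p≗q xs)
... | false = count-cong p≗q xs

count-gate : ∀ b (p : A → Bool) xs → count (λ x → b ∧ p x) xs ≡ (if b then count p xs else 0)
count-gate true  p xs       = refl
count-gate false p []       = refl
count-gate false p (x ∷ xs) = count-gate false p xs

count-map : ∀ (p : B → Bool) (f : A → B) xs → count p (map f xs) ≡ count (p ∘ f) xs
count-map p f []       = refl
count-map p f (x ∷ xs) with p (f x)
... | true  = cong suc (count-map p f xs)
... | false = count-map p f xs

count-concatMap : ∀ (p : B → Bool) (f : A → List B) xs →
                  count p (concatMap f xs) ≡ sum (map (count p ∘ f) xs)
count-concatMap p f []       = refl
count-concatMap p f (x ∷ xs) =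
  trans (count-++ p (f x) (concat (map f xs))) (cong (count p (f x) +_) (count-concatMap p f xs))

length-filter≡count : ∀ {P : Pred A ℓ′} (P? : Decidable P) xs →
                      length (filter P? xs) ≡ count (does ∘ P?) xs
length-filter≡count P? []       = refl
length-filter≡count P? (x ∷ xs) with does (P? x)
... | true  = cong suc (length-filter≡count P? xs)
... | false = length-filter≡count P? xs

sumFrom : ℕ → ℕ → (ℕ → ℕ) → ℕ
sumFrom zero    lo       h = 0
sumFrom (suc N) zero     h = h 0 + sumFrom N 0 (h ∘ suc)
sumFrom (suc N) (suc lo) h = sumFrom N lo (h ∘ suc)

sum-allFins≡sumFrom : ∀ N lo h →
  sum (map (λ x → if lo ≤ᵇ toℕ x then h (toℕ x) else 0) (allFins N)) ≡ sumFrom N lo h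
sum-allFins≡sumFrom zero    lo       h = refl
sum-allFins≡sumFrom (suc N) zero     h =
  cong (h 0 +_) (trans (cong sum (sym (map-∘ (allFins N)))) (sum-allFins≡sumFrom N 0 (h ∘ suc)))
sum-allFins≡sumFrom (suc N) (suc lo) h =
  trans (cong sum (trans (sym (map-∘ (allFins N)))
                         (map-cong (λ x → cong (if_then h (suc (toℕ x)) else 0) (≤ᵇ-suc lo (toℕ x)))
                                   (allFins N))))
        (sum-allFins≡sumFrom N lo (h ∘ suc))

sumFrom-step : ∀ {N lo} h → lo < N → sumFrom N lo h ≡ h lo + sumFrom N (suc lo) h
sumFrom-step {suc N} {zero}   h _         = refl
sumFrom-step {suc N} {suc lo} h (s≤s lo<N) = sumFrom-step (h ∘ suc) lo<N

sumFrom-empty : ∀ {N lo} h → N ≤ lo → sumFrom N lo h ≡ 0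
sumFrom-empty {zero}           h _          = refl
sumFrom-empty {suc N} {suc lo} h (s≤s N≤lo) = sumFrom-empty (h ∘ suc) N≤lo

sortedFrom : ∀ {n m} → ℕ → Vec (Fin n) m → Bool
sortedFrom lo []       = true
sortedFrom lo (x ∷ xs) = (lo ≤ᵇ toℕ x) ∧ sortedFrom (toℕ x) xs

sortedFrom-∷⁻ : ∀ {n m lo} (a : Fin n) (as : Vec (Fin n) m) →
                T (sortedFrom lo (a ∷ as)) → lo ≤ toℕ a × T (sortedFrom (toℕ a) as)
sortedFrom-∷⁻ {lo = lo} a as sorted with lo≤ᵇa , sorted-as ← Equivalence.to T-∧ sorted =
  ≤ᵇ⇒≤ lo (toℕ a) lo≤ᵇa , sorted-as

ordered⇔sorted : ∀ {n m} (x : Fin n) (xs : Vec (Fin n) m) →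
                 Ordered (x ∷ xs) ⇔ T (sortedFrom (toℕ x) xs)
ordered⇔sorted x xs = mk⇔ (to x xs) (from x xs)
  where
  to : ∀ {n m} (x : Fin n) (xs : Vec (Fin n) m) → Ordered (x ∷ xs) → T (sortedFrom (toℕ x) xs)
  to x []       _                      = _
  to x (y ∷ ys) (ord-∷ _ _ _ x≤y ord) = Equivalence.from T-∧ (≤⇒≤ᵇ x≤y , to y ys ord)
  from : ∀ {n m} (x : Fin n) (xs : Vec (Fin n) m) → T (sortedFrom (toℕ x) xs) → Ordered (x ∷ xs)
  from x []       _      = ord-[x] x
  from x (y ∷ ys) sorted with x≤y , sorted-ys ← sortedFrom-∷⁻ y ys sorted =
    ord-∷ x y ys x≤y (from y ys sorted-ys)

-- The R of the proof idea for m cars: in a sorted run, cars i, …, m all park at or right of xᵢ.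
reach : ∀ {n m} → Vec (Fin n) m → ℕ
reach []                   = 0
reach {m = suc m} (x ∷ xs) = toℕ x + suc m ⊔ reach xs

reach-≤ : ∀ {n m} (xs : Vec (Fin n) m) → reach xs ≤ n + m
reach-≤ []                       = z≤n
reach-≤ {n} {suc m} (x ∷ xs) =
  ⊔-lub (+-monoˡ-≤ (suc m) (<⇒≤ (toℕ<n x))) (≤-trans (reach-≤ xs) (+-monoʳ-≤ n (n≤1+n m)))

reach-≥ : ∀ {n m} (a : Vec (Fin n) (suc m)) → suc m ≤ reach a
reach-≥ {m = m} (x ∷ xs) = ≤-trans (m≤n+m (suc m) (toℕ x)) (m≤m⊔n _ (reach xs))

occupy : ∀ {n} → Occ n → Fin n → Occ n
occupy occ s = updateAt occ s (λ _ → true)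

-- Seen from a car preferring a space ≥ lo, the occupied spaces form the block [lo, t).
record Frontier {n} (occ : Occ n) (lo t : ℕ) : Set where
  field
    t≤n    : t ≤ n
    filled : ∀ j → lo ≤ toℕ j → toℕ j < t → lookup occ j ≡ true
    vacant : ∀ j → t ≤ toℕ j → lookup occ j ≡ false

frontier-empty : ∀ n → Frontier (replicate n false) 0 0
frontier-empty n = record
  { t≤n    = z≤n
  ; filled = λ _ _ ()
  ; vacant = λ j _ → lookup-replicate j false
  }

frontier-raise : ∀ {n lo lo′ t} {occ : Occ n} → lo ≤ lo′ → Frontier occ lo t → Frontier occ lo′ t
frontier-raise lo≤lo′ fr = record
  { t≤n    = t≤n
  ; filled = λ j lo′≤j → filled j (≤-trans lo≤lo′ lo′≤j)
  ; vacant = vacant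
  }
  where open Frontier fr

firstFreeFrom-gap : ∀ {n p} (occ : Occ n) (q : Fin n) → p ≤ toℕ q →
  (∀ j → p ≤ toℕ j → toℕ j < toℕ q → lookup occ j ≡ true) → lookup occ q ≡ false →
  firstFreeFrom occ p ≡ just q
firstFreeFrom-gap {p = zero}  (false ∷ occ) fzero     _ _ _ = refl
firstFreeFrom-gap {p = zero}  (b ∷ occ)     (fsuc q) _ taken free with b | taken fzero z≤n (s≤s z≤n)
... | true | refl =
  cong (Maybe.map fsuc) (firstFreeFrom-gap occ q z≤n (λ j _ j<q → taken (fsuc j) z≤n (s≤s j<q)) free)
firstFreeFrom-gap {p = suc p} (b ∷ occ)     (fsuc q) (s≤s p≤q) taken free =
  cong (Maybe.map fsuc)
       (firstFreeFrom-gap occ q p≤q (λ j p≤j j<q → taken (fsuc j) (s≤s p≤j) (s≤s j<q)) free)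

firstFreeFrom-full : ∀ {n p} (occ : Occ n) → (∀ j → p ≤ toℕ j → lookup occ j ≡ true) →
  firstFreeFrom occ p ≡ nothing
firstFreeFrom-full []                     taken = refl
firstFreeFrom-full {p = zero}  (b ∷ occ) taken with b | taken fzero z≤n
... | true | refl = cong (Maybe.map fsuc) (firstFreeFrom-full occ (λ j _ → taken (fsuc j) z≤n))
firstFreeFrom-full {p = suc p} (b ∷ occ) taken =
  cong (Maybe.map fsuc) (firstFreeFrom-full occ (λ j p≤j → taken (fsuc j) (s≤s p≤j)))

module _ {n lo t} {occ : Occ n} (fr : Frontier occ lo t) where
  open Frontier fr

  firstFreeFrom-frontier : ∀ {a} → lo ≤ a → (s : Fin n) → toℕ s ≡ a ⊔ t →
                           firstFreeFrom occ a ≡ just s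
  firstFreeFrom-frontier {a} lo≤a s s≡a⊔t = firstFreeFrom-gap occ s a≤s taken (vacant s t≤s)
    where
    a≤s : a ≤ toℕ s
    a≤s = subst (a ≤_) (sym s≡a⊔t) (m≤m⊔n a t)
    t≤s : t ≤ toℕ s
    t≤s = subst (t ≤_) (sym s≡a⊔t) (m≤n⊔m a t)
    taken : ∀ j → a ≤ toℕ j → toℕ j < toℕ s → lookup occ j ≡ true
    taken j a≤j j<s = filled j (≤-trans lo≤a a≤j) (<-⊔-cancelˡ (subst (toℕ j <_) s≡a⊔t j<s) a≤j)

  firstFreeFrom-frontier-full : ∀ {a} → t ≡ n → lo ≤ a → firstFreeFrom occ a ≡ nothing
  firstFreeFrom-frontier-full t≡n lo≤a = firstFreeFrom-full occ
    (λ j a≤j → filled j (≤-trans lo≤a a≤j) (subst (toℕ j <_) (sym t≡n) (toℕ<n j)))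

  frontier-occupy : ∀ {a} → lo ≤ a → (s : Fin n) → toℕ s ≡ a ⊔ t →
                    Frontier (occupy occ s) a (suc (toℕ s))
  frontier-occupy {a} lo≤a s s≡a⊔t = record
    { t≤n    = toℕ<n s
    ; filled = filled′
    ; vacant = vacant′
    }
    where
    filled′ : ∀ j → a ≤ toℕ j → toℕ j < suc (toℕ s) → lookup (occupy occ s) j ≡ true
    filled′ j a≤j j≤s with j Fin.≟ s
    ... | yes refl = lookup∘updateAt s occ
    ... | no  j≢s  = trans (lookup∘updateAt′ j s j≢s occ)
      (filled j (≤-trans lo≤a a≤j)
        (<-⊔-cancelˡ (subst (toℕ j <_) s≡a⊔t (≤∧≢⇒< (≤-pred j≤s) (j≢s ∘ toℕ-injective))) a≤j))
    vacant′ : ∀ j → suc (toℕ s) ≤ toℕ j → lookup (occupy occ s) j ≡ false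
    vacant′ j s<j =
      trans (lookup∘updateAt′ j s (λ j≡s → <-irrefl (cong toℕ (sym j≡s)) s<j) occ)
            (vacant j (≤-trans (subst (t ≤_) (sym s≡a⊔t) (m≤n⊔m a t)) (<⇒≤ s<j)))

⊔-advance : ∀ a t m r → suc (a ⊔ t) + m ⊔ r ≡ t + suc m ⊔ (a + suc m ⊔ r)
⊔-advance a t m r = begin
  suc (a ⊔ t) + m ⊔ r              ≡⟨ cong (_⊔ r) (+-suc (a ⊔ t) m) ⟨
  a ⊔ t + suc m ⊔ r                ≡⟨ cong (_⊔ r) (+-distribʳ-⊔ (suc m) a t) ⟩
  (a + suc m ⊔ (t + suc m)) ⊔ r    ≡⟨ cong (_⊔ r) (⊔-comm (a + suc m) (t + suc m)) ⟩
  (t + suc m ⊔ (a + suc m)) ⊔ r    ≡⟨ ⊔-assoc (t + suc m) (a + suc m) r ⟩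
  t + suc m ⊔ (a + suc m ⊔ r)      ∎
  where open ≡-Reasoning

⊔-overflow : ∀ {n a m r} → a < n → r ≤ n + m →
             suc ((n + m ⊔ r) ∸ n) ≡ (n + suc m ⊔ (a + suc m ⊔ r)) ∸ n
⊔-overflow {n} {a} {m} {r} a<n r≤n+m = begin
  suc ((n + m ⊔ r) ∸ n)                ≡⟨ cong (λ z → suc (z ∸ n)) (m≥n⇒m⊔n≡m r≤n+m) ⟩
  suc (n + m ∸ n)                      ≡⟨ cong suc (m+n∸m≡n n m) ⟩
  suc m                                ≡⟨ m+n∸m≡n n (suc m) ⟨
  n + suc m ∸ n                        ≡⟨ cong (_∸ n) (m≥n⇒m⊔n≡m bound) ⟨
  (n + suc m ⊔ (a + suc m ⊔ r)) ∸ n    ∎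
  where
  open ≡-Reasoning
  bound : a + suc m ⊔ r ≤ n + suc m
  bound = ⊔-lub (+-monoˡ-≤ (suc m) (<⇒≤ a<n)) (≤-trans r≤n+m (+-monoʳ-≤ n (n≤1+n m)))

-- While t < n the next car parks at (its preference) ⊔ t; once t = n every remaining car
-- overflows.
parkFlaws-sorted : ∀ {n m lo t} (occ : Occ n) (as : Vec (Fin n) m) → Frontier occ lo t →
                   T (sortedFrom lo as) → parkFlaws occ as ≡ (t + m ⊔ reach as) ∸ n
parkFlaws-sorted {n} {t = t} occ [] fr _ =
  sym (m≤n⇒m∸n≡0 (⊔-lub (subst (_≤ n) (sym (+-identityʳ t)) (Frontier.t≤n fr)) z≤n))
parkFlaws-sorted {n} {suc m} {lo} {t} occ (a ∷ as) fr sorted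
  with lo≤a , sorted-as ← sortedFrom-∷⁻ a as sorted | toℕ a ⊔ t <? n
... | yes a⊔t<n rewrite firstFreeFrom-frontier fr lo≤a (fromℕ< a⊔t<n) (toℕ-fromℕ< a⊔t<n) = begin
    parkFlaws (occupy occ s) as                  ≡⟨ parkFlaws-sorted (occupy occ s) as
                                                      (frontier-occupy fr lo≤a s s≡a⊔t) sorted-as ⟩
    (suc (toℕ s) + m ⊔ reach as) ∸ n             ≡⟨ cong (λ z → (suc z + m ⊔ reach as) ∸ n) s≡a⊔t ⟩
    (suc (toℕ a ⊔ t) + m ⊔ reach as) ∸ n         ≡⟨ cong (_∸ n) (⊔-advance (toℕ a) t m (reach as)) ⟩
    (t + suc m ⊔ (toℕ a + suc m ⊔ reach as)) ∸ n ∎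
  where
  open ≡-Reasoning
  s : Fin n
  s = fromℕ< a⊔t<n
  s≡a⊔t : toℕ s ≡ toℕ a ⊔ t
  s≡a⊔t = toℕ-fromℕ< a⊔t<n
... | no a⊔t≮n with refl ← ⊔-blocked (toℕ<n a) (Frontier.t≤n fr) a⊔t≮n
  rewrite firstFreeFrom-frontier-full fr refl lo≤a =
  trans (cong suc (parkFlaws-sorted occ as (frontier-raise lo≤a fr) sorted-as))
        (⊔-overflow (toℕ<n a) (reach-≤ as))

flaws-sorted : ∀ {n} (a : PrefSet n) → T (sortedFrom 0 a) → flaws a ≡ (n ⊔ reach a) ∸ n
flaws-sorted {n} a = parkFlaws-sorted (replicate n false) a (frontier-empty n)

flaws≡reach∸n : ∀ {n} (a : PrefSet (suc n)) → T (sortedFrom 0 a) → flaws a ≡ reach a ∸ suc n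
flaws≡reach∸n {n} a sorted =
  trans (flaws-sorted a sorted) (cong (_∸ suc n) (m≤n⇒m⊔n≡n (reach-≥ a)))

countReach : (n m lo c : ℕ) → ℕ
countReach n m lo c = count (λ (v : Vec (Fin n) m) → sortedFrom lo v ∧ (c ≤ᵇ reach v)) (allVecs n m)

-- The tails v for which i ∷ v is counted by countReach n (suc m) lo c, when lo ≤ i.
countTails : (n m c i : ℕ) → ℕ
countTails n m c i =
  count (λ (v : Vec (Fin n) m) → sortedFrom i v ∧ (c ≤ᵇ i + suc m ⊔ reach v)) (allVecs n m)

countReach-suc : ∀ n m lo c → countReach n (suc m) lo c ≡ sumFrom n lo (countTails n m c)
countReach-suc n m lo c = begin
  count p (concatMap (λ x → map (x ∷_) (allVecs n m)) (allFins n))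
    ≡⟨ count-concatMap p (λ x → map (x ∷_) (allVecs n m)) (allFins n) ⟩
  sum (map (λ x → count p (map (x ∷_) (allVecs n m))) (allFins n))
    ≡⟨ cong sum (map-cong split-head (allFins n)) ⟩
  sum (map (λ x → if lo ≤ᵇ toℕ x then countTails n m c (toℕ x) else 0) (allFins n))
    ≡⟨ sum-allFins≡sumFrom n lo (countTails n m c) ⟩
  sumFrom n lo (countTails n m c) ∎
  where
  open ≡-Reasoning
  p : Vec (Fin n) (suc m) → Bool
  p v = sortedFrom lo v ∧ (c ≤ᵇ reach v)
  split-head : ∀ x → count p (map (x ∷_) (allVecs n m))
                     ≡ (if lo ≤ᵇ toℕ x then countTails n m c (toℕ x) else 0)
  split-head x = begin
    count p (map (x ∷_) (allVecs n m))   ≡⟨ count-map p (x ∷_) (allVecs n m) ⟩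
    count (p ∘ (x ∷_)) (allVecs n m)     ≡⟨ count-cong (λ v → ∧-assoc (lo ≤ᵇ toℕ x) _ _) (allVecs n m) ⟩
    count (λ v → (lo ≤ᵇ toℕ x) ∧ (sortedFrom (toℕ x) v ∧ (c ≤ᵇ toℕ x + suc m ⊔ reach v)))
          (allVecs n m)
      ≡⟨ count-gate (lo ≤ᵇ toℕ x) _ (allVecs n m) ⟩
    (if lo ≤ᵇ toℕ x then countTails n m c (toℕ x) else 0) ∎

countReach-step : ∀ {n lo} m c → lo < n →
                  countReach n (suc m) lo c ≡ countTails n m c lo + countReach n (suc m) (suc lo) c
countReach-step {n} {lo} m c lo<n = begin
  countReach n (suc m) lo c
    ≡⟨ countReach-suc n m lo c ⟩
  sumFrom n lo (countTails n m c)
    ≡⟨ sumFrom-step (countTails n m c) lo<n ⟩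
  countTails n m c lo + sumFrom n (suc lo) (countTails n m c)
    ≡⟨ cong (countTails n m c lo +_) (countReach-suc n m (suc lo) c) ⟨
  countTails n m c lo + countReach n (suc m) (suc lo) c ∎
  where open ≡-Reasoning

countReach-exhausted : ∀ {n lo} m c → n ≤ lo → countReach n (suc m) lo c ≡ 0
countReach-exhausted {n} {lo} m c n≤lo =
  trans (countReach-suc n m lo c) (sumFrom-empty (countTails n m c) n≤lo)

countTails-reached : ∀ {n m c i} → c ≤ i + suc m → countTails n m c i ≡ countReach n m i 0
countTails-reached {n} {m} {c} {i} c≤ = count-cong
  (λ v → cong (sortedFrom i v ∧_) (dec-true (c ≤? _) (≤-trans c≤ (m≤m⊔n _ (reach v)))))
  (allVecs n m)

countTails-unreached : ∀ {n m c i} → i + suc m < c → countTails n m c i ≡ countReach n m i c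
countTails-unreached {n} {m} {c} {i} <c = count-cong
  (λ v → cong (sortedFrom i v ∧_) (does-⇔ (drop-head (reach v)) (c ≤? _) (c ≤? reach v)))
  (allVecs n m)
  where
  drop-head : ∀ r → c ≤ i + suc m ⊔ r ⇔ c ≤ r
  drop-head r = mk⇔ (λ c≤ → ≮⇒≥ (λ r<c → <⇒≱ (⊔-lub <c r<c) c≤))
                    (λ c≤r → ≤-trans c≤r (m≤n⊔m _ r))

-- The value of countReach n m lo c when lo + d ≡ n; for c ≤ lo + m, the least possible reach,
-- it is the number of multisets of size m from d values.
reachBinom : (m d lo c : ℕ) → ℕ
reachBinom m d lo c = (m + d ∸ 1) C (m + (c ∸ (lo + m)))

reachBinom-pascal-reached : ∀ m d lo c → c ≤ lo + suc m →
  reachBinom m (suc d) lo 0 + reachBinom (suc m) d (suc lo) c ≡ reachBinom (suc m) (suc d) lo c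
reachBinom-pascal-reached m d lo c c≤ = begin
  (m + suc d ∸ 1) C (m + (0 ∸ (lo + m))) + (m + d) C (suc m + (c ∸ (suc lo + suc m)))
    ≡⟨ cong₂ _+_ (cong₂ _C_ (cong (_∸ 1) (+-suc m d))
                            (trans (cong (m +_) (0∸n≡0 (lo + m))) (+-identityʳ m)))
                 (cong (λ e → (m + d) C (suc m + e)) (m≤n⇒m∸n≡0 (m≤n⇒m≤1+n c≤))) ⟩
  (m + d) C m + (m + d) C (suc m + 0)
    ≡⟨ cong (λ k → (m + d) C m + (m + d) C k) (+-identityʳ (suc m)) ⟩
  (m + d) C m + (m + d) C suc m
    ≡⟨ nCk+nC[k+1]≡[n+1]C[k+1] (m + d) m ⟩
  suc (m + d) C suc m
    ≡⟨ cong₂ _C_ (+-suc m d) (trans (cong (suc m +_) (m≤n⇒m∸n≡0 c≤)) (+-identityʳ (suc m))) ⟨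
  (m + suc d) C (suc m + (c ∸ (lo + suc m))) ∎
  where open ≡-Reasoning

reachBinom-pascal-unreached : ∀ m d lo c → lo + suc m < c →
  reachBinom m (suc d) lo c + reachBinom (suc m) d (suc lo) c ≡ reachBinom (suc m) (suc d) lo c
reachBinom-pascal-unreached m d lo c <c = begin
  (m + suc d ∸ 1) C (m + (c ∸ (lo + m))) + (m + d) C (suc m + e)
    ≡⟨ cong (λ z → z + (m + d) C (suc m + e))
            (cong₂ _C_ (cong (_∸ 1) (+-suc m d)) (cong (m +_) excess-twice)) ⟩
  (m + d) C (m + suc (suc e)) + (m + d) C (suc m + e)
    ≡⟨ cong (λ k → (m + d) C k + (m + d) C (suc m + e))
            (trans (+-suc m (suc e)) (cong suc (+-suc m e))) ⟩
  (m + d) C suc (suc m + e) + (m + d) C (suc m + e)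
    ≡⟨ +-comm ((m + d) C suc (suc m + e)) _ ⟩
  (m + d) C (suc m + e) + (m + d) C suc (suc m + e)
    ≡⟨ nCk+nC[k+1]≡[n+1]C[k+1] (m + d) (suc m + e) ⟩
  suc (m + d) C suc (suc m + e)
    ≡⟨ cong₂ _C_ (+-suc m d) (trans (cong (suc m +_) excess-once) (+-suc (suc m) e)) ⟨
  (m + suc d) C (suc m + (c ∸ (lo + suc m))) ∎
  where
  open ≡-Reasoning
  e : ℕ
  e = c ∸ (suc lo + suc m)
  excess-once : c ∸ (lo + suc m) ≡ suc e
  excess-once = ∸-sucʳ <c
  excess-twice : c ∸ (lo + m) ≡ suc (suc e)
  excess-twice = begin
    c ∸ (lo + m)            ≡⟨ ∸-sucʳ (≤-trans (s≤s (+-monoʳ-≤ lo (n≤1+n m))) <c) ⟩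
    suc (c ∸ suc (lo + m))  ≡⟨ cong (λ x → suc (c ∸ x)) (+-suc lo m) ⟨
    suc (c ∸ (lo + suc m))  ≡⟨ cong suc excess-once ⟩
    suc (suc e)             ∎

-- The threshold must be trivial or beyond the last space: for 0 < c < n the case m = 0 fails.
countReach-closed : ∀ {n} m d lo c → lo + d ≡ n → c ≡ 0 ⊎ n ≤ c → 0 < m + d →
                    countReach n m lo c ≡ reachBinom m d lo c
countReach-closed zero zero    _  _ _ _ ()
countReach-closed zero (suc d) lo _ _ (inj₁ refl) _ = cong (d C_) (sym (0∸n≡0 (lo + 0)))
countReach-closed zero (suc d) lo zero lo+d≡n (inj₂ n≤0) _ =
  contradiction (≤-trans (m≤n+m (suc d) lo) (≤-trans (≤-reflexive lo+d≡n) n≤0)) λ ()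
countReach-closed zero (suc d) lo (suc c) lo+d≡n (inj₂ n≤c) _ = sym (k>n⇒nCk≡0 d<excess)
  where
  d<excess : d < suc c ∸ (lo + 0)
  d<excess = subst (λ x → suc d ≤ suc c ∸ x) (sym (+-identityʳ lo))
               (m+n≤o⇒m≤o∸n (suc d) (≤-trans (≤-reflexive (trans (+-comm (suc d) lo) lo+d≡n)) n≤c))
countReach-closed (suc m) zero lo c lo+0≡n _ _ =
  trans (countReach-exhausted m c (≤-reflexive (trans (sym lo+0≡n) (+-identityʳ lo))))
        (sym (k>n⇒nCk≡0 (s≤s (≤-trans (≤-reflexive (+-identityʳ m)) (m≤m+n m _)))))
countReach-closed {n} (suc m) (suc d) lo c lo+d≡n c-range _ = begin
  countReach n (suc m) lo c                             ≡⟨ countReach-step m c lo<n ⟩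
  countTails n m c lo + countReach n (suc m) (suc lo) c ≡⟨ cong (countTails n m c lo +_) rest ⟩
  countTails n m c lo + reachBinom (suc m) d (suc lo) c ≡⟨ tails+rest (c ≤? lo + suc m) ⟩
  reachBinom (suc m) (suc d) lo c                       ∎
  where
  open ≡-Reasoning
  lo<n : lo < n
  lo<n = ≤-trans (m<m+n lo (s≤s z≤n)) (≤-reflexive lo+d≡n)
  0<m+d : 0 < m + suc d
  0<m+d = ≤-trans (s≤s z≤n) (m≤n+m (suc d) m)
  rest : countReach n (suc m) (suc lo) c ≡ reachBinom (suc m) d (suc lo) c
  rest = countReach-closed (suc m) d (suc lo) c (trans (sym (+-suc lo d)) lo+d≡n) c-range (s≤s z≤n)
  tails+rest : Dec (c ≤ lo + suc m) →
               countTails n m c lo + reachBinom (suc m) d (suc lo) c ≡ reachBinom (suc m) (suc d) lo c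
  tails+rest (yes c≤) = trans
    (cong (_+ _) (trans (countTails-reached c≤)
                        (countReach-closed m (suc d) lo 0 lo+d≡n (inj₁ refl) 0<m+d)))
    (reachBinom-pascal-reached m d lo c c≤)
  tails+rest (no c≰) = trans
    (cong (_+ _) (trans (countTails-unreached (≰⇒> c≰))
                        (countReach-closed m (suc d) lo c lo+d≡n c-range 0<m+d)))
    (reachBinom-pascal-unreached m d lo c (≰⇒> c≰))

flaws≥⇔reach≥ : ∀ {n} k (a : PrefSet (suc n)) → T (sortedFrom 0 a) →
                k ≤ flaws a ⇔ k + suc n ≤ reach a
flaws≥⇔reach≥ k a sorted rewrite flaws≡reach∸n a sorted =
  mk⇔ (m≤o∸n⇒m+n≤o k (reach-≥ a)) (m+n≤o⇒m≤o∸n k)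

op≥≡countReach : ∀ n k → op≥ (suc n) k ≡ countReach (suc n) (suc n) 0 (k + suc n)
op≥≡countReach n k =
  trans (length-filter≡count P? (allVecs N N))
        (count-cong (λ a → does-⇔ (P⇔ a) (P? a) (T? _)) (allVecs N N))
  where
  open Equivalence using (to; from)
  N : ℕ
  N = suc n
  P? : ∀ a → Dec (Ordered a × k ≤ flaws a)
  P? a = ordered? a ×-dec (k ≤? flaws a)
  P⇔ : ∀ a → (Ordered a × k ≤ flaws a) ⇔ T (sortedFrom 0 a ∧ (k + N ≤ᵇ reach a))
  P⇔ a@(x ∷ xs) = mk⇔
    (λ (ordered , k≤flaws) →
       let sorted = to (ordered⇔sorted x xs) ordered
       in from T-∧ (sorted , ≤⇒≤ᵇ (to (flaws≥⇔reach≥ k a sorted) k≤flaws)))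
    (λ sorted∧reached →
       let sorted , reached = to T-∧ sorted∧reached
       in from (ordered⇔sorted x xs) sorted , from (flaws≥⇔reach≥ k a sorted) (≤ᵇ⇒≤ _ _ reached))

mainTheorem2 : (n k : ℕ) → 1 ≤ n → k ≤ n ∸ 1 →
    op≥ n k ≡ (2 * n ∸ 1) C (n ∸ 1 ∸ k)
mainTheorem2 (suc n) k _ k≤n = begin
  op≥ N k
    ≡⟨ op≥≡countReach n k ⟩
  countReach N N 0 (k + N)
    ≡⟨ countReach-closed N N 0 (k + N) refl (inj₂ (m≤n+m N k)) (s≤s z≤n) ⟩
  (n + N) C (N + (k + N ∸ N))
    ≡⟨ cong (λ i → (n + N) C (N + i)) (m+n∸n≡m k N) ⟩
  (n + N) C (N + k)
    ≡⟨ nCk≡nC[n∸k] (subst (N + k ≤_) (+-comm N n) (+-monoʳ-≤ N k≤n)) ⟩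
  (n + N) C (n + N ∸ (N + k))
    ≡⟨ cong₂ _C_ (cong (n +_) (sym (+-identityʳ N)))
                 (trans (cong (_∸ (N + k)) (+-comm n N)) ([m+n]∸[m+o]≡n∸o N n k)) ⟩
  (2 * N ∸ 1) C (n ∸ k) ∎
  where
  open ≡-Reasoning
  N : ℕ
  N = suc n
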